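{- Let $\mathcal N$ be a network of timed automata. If $(q,v)\xrightarrow{u}(q',v')$ is a global run, then there is a local run $(q,\mathrm{local}(v))\Rightarrow^u(q',\mathrm{local}(v'))$.
   Context: Network: $\mathcal N=\langle A_1,\dots,A_k\rangle$, each $A_p=(Q_p,\Sigma_p,X_p,q^{init}_p,T_p)$ with finite state set $Q_p$, finite alphabet $\Sigma_p$, finite clock set $X_p$, initial state $q^{init}_p$, transitions $T_p\subseteq\Sigma_p\times Q_p\times\Phi(X_p)\times2^{X_p}\times Q_p$ with $\Phi(X_p)$ finite conjunctions of atoms $x\sim c$ ($c\in\mathbb N$, $\sim\in\{<,\le,=,\ge,>\}$). $Q_p$ pairwise disjoint, $X_p$ pairwise disjoint; $Q=\prod_pQ_p$, $q(p)$ the $p$-th component, $\Sigma=\bigcup\Sigma_p$, $X=\bigcup X_p$, $\mathrm{dom}(b)=\{p:b\in\Sigma_p\}$. Offset variables $\tilde x$ for $x\in X$, $\tilde X_p=\{\tilde x:x\in X_p\}$, $\tilde X=\bigcup\tilde X_p$. Global semantics: a global valuation is $v:\tilde X\cup\{t\}\to\mathbb R_{\ge0}$ with $v(t)\ge v(\tilde x)$; clock $x$ has value $v(t)-v(\tilde x)$, $v\models g$ defined by these values; $v+\delta$ adds $\delta$ to $t$ only; $[R]v$ sets $\tilde x:=v(t)$ for $x\in R$. Steps $(q,v)\xrightarrow{\delta}(q,v+\delta)$, and $(q,v)\xrightarrow{b}(q',v')$ if there are $b$-transitions $(b,q_p,g_p,R_p,q'_p)\in T_p$, $p\in\mathrm{dom}(b)$,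 with $q_p=q(p)$, $q'_p=q'(p)$ for $p\in\mathrm{dom}(b)$, $q'(p)=q(p)$ otherwise, $v\models g_p$, $v'=[\bigcup_pR_p]v$. For $u=b_1\cdots b_n$, $(q_0,v_0)\xrightarrow{u}(q_n,v_n')$ means there are delays $\delta_0,\dots,\delta_n\ge0$ with $(q_0,v_0)\xrightarrow{\delta_0}\xrightarrow{b_1}\xrightarrow{\delta_1}\cdots\xrightarrow{b_n}\xrightarrow{\delta_n}(q_n,v_n')$. Local semantics: reference clock $t_p$ per process; a local valuation is $\nu:\tilde X\cup\{t_1,\dots,t_k\}\to\mathbb R_{\ge0}$ with $\nu(t_p)\ge\nu(\tilde x)$ for $\tilde x\in\tilde X_p$; value of $x\in X_p$ is $\nu(t_p)-\nu(\tilde x)$; $\nu+_p\delta$ adds $\delta$ to $t_p$ only; $[R]\nu$ sets $\tilde x:=\nu(t_p)$ for $x\in R\cap X_p$. Local steps: $(q,\nu)\Rightarrow_{p,\delta}(q,\nu+_p\delta)$; $(q,\nu)\Rightarrow_b(q',\nu')$ under the same conditions as global action steps with $v$ replaced by $\nu$, plus $\nu(t_{p_1})=\nu(t_{p_2})$ for all $p_1,p_2\in\mathrm{dom}(b)$. $(q_0,\nu_0)\Rightarrow^u(q_n,\nu_n')$ means $(q_0,\nu_0)\Rightarrow_{\Delta_0}\Rightarrow_{b_1}\Rightarrow_{\Delta_1}\cdots\Rightarrow_{b_n}\Rightarrow_{\Delta_n}(q_n,\nu'_n)$ for finite sequences of local delays $\Delta_i$ applied successively. For a global valuation $v$, $\mathrm{local}(v)$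 is the local valuation with the same offsets and $\mathrm{local}(v)(t_p)=v(t)$ for all $p$. -}

module Defs where

open import Data.Nat using (ℕ)
open import Data.Fin using (Fin)
open import Data.Fin.Subset using (Subset; _∈_; _∉_)
open import Data.List using (List; []; _∷_)
open import Data.List.Membership.Propositional using () renaming (_∈_ to _∈ₗ_)
open import Data.List.Relation.Unary.All using (All)
open import Data.Product using (Σ; Σ-syntax; ∃; ∃-syntax; _×_)
open import Relation.Binary.PropositionalEquality using (_≡_)
open import Relation.Nullary using (¬_)

-- Intended instance: ℝ≥0 with its order, addition,
-- (truncated) subtraction, 0 and the embedding ℕ → ℝ≥0.  Agda's
-- standard library has no reals, so the statement is made for an
-- arbitrary such structure (no laws are assumed).

record TimeDomain : Set₁ where
  field
    T   : Set
    _≤_ : T → T → Set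
    _<_ : T → T → Set
    _+_ : T → T → T
    _-_ : T → T → T
    𝟘   : T
    ι   : ℕ → T

data Cmp : Set where
  lt le eq ge gt : Cmp

record Atom (n : ℕ) : Set where
  constructor atom
  field
    clk : Fin n
    cmp : Cmp
    cst : ℕ

Guard : ℕ → Set
Guard n = List (Atom n)

record Trans (nΣ : ℕ) (Σp : Subset nΣ) (nQ nX : ℕ) : Set where
  field
    act   : Fin nΣ
    act∈  : act ∈ Σp
    src   : Fin nQ
    guard : Guard nX
    reset : Subset nX
    tgt   : Fin nQ

record Network : Set₁ where
  field
    k     : ℕ
    nΣ    : ℕ
    Σp    : Fin k → Subset nΣ
    cover : (b : Fin nΣ) → ∃[ p ] (b ∈ Σp p)
    nQ    : Fin k → ℕ
    nX    : Fin k → ℕ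
    qinit : (p : Fin k) → Fin (nQ p)
  field
    Tr : (p : Fin k) → List (Trans nΣ (Σp p) (nQ p) (nX p))

  _∈dom_ : Fin k → Fin nΣ → Set
  p ∈dom b = b ∈ Σp p

  State : Set
  State = (p : Fin k) → Fin (nQ p)

module Sem (D : TimeDomain) (N : Network) where
  open TimeDomain D
  open Network N

  -- satisfaction of a guard of process p, given the reference time tp
  -- and the offsets of p's clocks; value of x is tp - offset(x)
  SatAtom : {n : ℕ} → T → (Fin n → T) → Atom n → Set
  SatAtom tp o (atom x lt c) = (tp - o x) < ι c
  SatAtom tp o (atom x le c) = (tp - o x) ≤ ι c
  SatAtom tp o (atom x eq c) = (tp - o x) ≡ ι c
  SatAtom tp o (atom x ge c) = ι c ≤ (tp - o x)
  SatAtom tp o (atom x gt c) = ι c < (tp - o x)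

  Sat : {n : ℕ} → T → (Fin n → T) → Guard n → Set
  Sat tp o g = All (SatAtom tp o) g

  Offsets : Set
  Offsets = (p : Fin k) → Fin (nX p) → T

  record GVal : Set where
    constructor gval
    field
      off : Offsets
      now : T
  open GVal public

  record LVal : Set where
    constructor lval
    field
      loff : Offsets
      lnow : Fin k → T
  open LVal public

  GValid : GVal → Set
  GValid v = (p : Fin k) (x : Fin (nX p)) → off v p x ≤ now v

  LValid : LVal → Set
  LValid ν = (p : Fin k) (x : Fin (nX p)) → loff ν p x ≤ lnow ν p

  local : GVal → LVal
  local v = lval (off v) (λ _ → now v)

  TransP : Fin k → Set
  TransP p = Trans nΣ (Σp p) (nQ p) (nX p)

  Choice : Fin nΣ → Set
  Choice b = (p : Fin k) → p ∈dom b → TransP p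

  InReset : {b : Fin nΣ} → Choice b → (p : Fin k) → Fin (nX p) → Set
  InReset {b} tr p x = Σ[ h ∈ p ∈dom b ] (x ∈ Trans.reset (tr p h))

  Fits : (b : Fin nΣ) → Choice b → State → State → ((p : Fin k) → T) → Offsets → Set
  Fits b tr q q' tp o =
      ((p : Fin k) (h : p ∈dom b) →
          (tr p h ∈ₗ Tr p) × (Trans.act (tr p h) ≡ b)
        × (Trans.src (tr p h) ≡ q p) × (Trans.tgt (tr p h) ≡ q' p)
        × Sat (tp p) (o p) (Trans.guard (tr p h)))
    × ((p : Fin k) → ¬ (p ∈dom b) → q' p ≡ q p)

  GDelay : State → GVal → T → State → GVal → Set
  GDelay q v δ q' v' =
      GValid v × GValid v' × (𝟘 ≤ δ)
    × ((p : Fin k) → q' p ≡ q p)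
    × ((p : Fin k) (x : Fin (nX p)) → off v' p x ≡ off v p x)
    × (now v' ≡ (now v + δ))

  GAct : State → GVal → Fin nΣ → State → GVal → Set
  GAct q v b q' v' =
      GValid v × GValid v'
    × Σ[ tr ∈ Choice b ]
        ( Fits b tr q q' (λ _ → now v) (off v)
        × (now v' ≡ now v)
        × ((p : Fin k) (x : Fin (nX p)) → InReset tr p x → off v' p x ≡ now v)
        × ((p : Fin k) (x : Fin (nX p)) → ¬ InReset tr p x → off v' p x ≡ off v p x))

  GRun : State → GVal → List (Fin nΣ) → State → GVal → Set
  GRun q v [] q' v' = ∃[ δ ] GDelay q v δ q' v'
  GRun q v (b ∷ u) q' v' =
    Σ[ q₁ ∈ State ] Σ[ v₁ ∈ GVal ] Σ[ q₂ ∈ State ] Σ[ v₂ ∈ GVal ]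
      (∃[ δ ] GDelay q v δ q₁ v₁) × GAct q₁ v₁ b q₂ v₂ × GRun q₂ v₂ u q' v'

  LDelay : State → LVal → Fin k → T → State → LVal → Set
  LDelay q ν p δ q' ν' =
      LValid ν × LValid ν' × (𝟘 ≤ δ)
    × ((r : Fin k) → q' r ≡ q r)
    × ((r : Fin k) (x : Fin (nX r)) → loff ν' r x ≡ loff ν r x)
    × (lnow ν' p ≡ (lnow ν p + δ))
    × ((r : Fin k) → ¬ (r ≡ p) → lnow ν' r ≡ lnow ν r)

  -- configurations equal componentwise (used instead of ≡ on
  -- function-valued components, since Agda has no function extensionality)
  SameConf : State → LVal → State → LVal → Set
  SameConf q ν q' ν' =
      ((p : Fin k) → q' p ≡ q p)
    × ((p : Fin k) (x : Fin (nX p)) → loff ν' p x ≡ loff ν p x)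
    × ((p : Fin k) → lnow ν' p ≡ lnow ν p)

  data LDelays : State → LVal → State → LVal → Set where
    done : ∀ {q ν q' ν'} → SameConf q ν q' ν' → LDelays q ν q' ν'
    step : ∀ {q ν q₁ ν₁ q' ν'} (p : Fin k) (δ : T) →
           LDelay q ν p δ q₁ ν₁ → LDelays q₁ ν₁ q' ν' → LDelays q ν q' ν'

  LAct : State → LVal → Fin nΣ → State → LVal → Set
  LAct q ν b q' ν' =
      LValid ν × LValid ν'
    × ((p₁ p₂ : Fin k) → p₁ ∈dom b → p₂ ∈dom b → lnow ν p₁ ≡ lnow ν p₂)
    × Σ[ tr ∈ Choice b ]
        ( Fits b tr q q' (lnow ν) (loff ν)
        × ((p : Fin k) → lnow ν' p ≡ lnow ν p)
        × ((p : Fin k) (x : Fin (nX p)) → InReset tr p x → loff ν' p x ≡ lnow ν p)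
        × ((p : Fin k) (x : Fin (nX p)) → ¬ InReset tr p x → loff ν' p x ≡ loff ν p x))

  LRun : State → LVal → List (Fin nΣ) → State → LVal → Set
  LRun q ν [] q' ν' = LDelays q ν q' ν'
  LRun q ν (b ∷ u) q' ν' =
    Σ[ q₁ ∈ State ] Σ[ ν₁ ∈ LVal ] Σ[ q₂ ∈ State ] Σ[ ν₂ ∈ LVal ]
      LDelays q ν q₁ ν₁ × LAct q₁ ν₁ b q₂ ν₂ × LRun q₂ ν₂ u q' ν'

module Submission where

open import Defs
open import Data.Fin using (Fin; toℕ; fromℕ<)
open import Data.Fin.Properties using (toℕ<n; toℕ-fromℕ<; toℕ-injective)
open import Data.List using (List; []; _∷_)
open import Data.Nat using (ℕ; zero; suc; z≤n; _≤?_) renaming (_≤_ to _≤ℕ_)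
open import Data.Nat.Properties using (<⇒≤; <⇒≱; ≤∧≢⇒<; ≤-refl; ≤-reflexive; <-irrefl)
open import Data.Product using (_,_)
open import Relation.Nullary using (yes; no; ¬_; contradiction)
open import Relation.Binary.PropositionalEquality using (_≡_; _≢_; refl; sym; trans; cong; subst)

-- Action steps of a global run are local action steps, since in local(v) all
-- reference clocks agree.  A global delay by δ is simulated by letting the
-- processes delay by δ one after another.  The time domain has no laws, so
-- the intermediate local valuations are not described arithmetically: each
-- reference clock is at either the old or the new global time, and validity
-- of every intermediate valuation is inherited from the two endpoints.

module _ (D : TimeDomain) (N : Network) where
  open TimeDomain D
  open Network N
  open Sem D N

  advancedFrom : ℕ → T → T → Fin k → T
  advancedFrom i a b r with i ≤? toℕ r
  ... | yes _ = a
  ... | no _  = b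

  advancedFrom-either : ∀ {P : T → Set} {a b} i r → P a → P b → P (advancedFrom i a b r)
  advancedFrom-either i r pa pb with i ≤? toℕ r
  ... | yes _ = pa
  ... | no _  = pb

  advancedFrom-zero : ∀ a b r → advancedFrom 0 a b r ≡ a
  advancedFrom-zero a b r with 0 ≤? toℕ r
  ... | yes _  = refl
  ... | no 0≰r = contradiction z≤n 0≰r

  advancedFrom-k : ∀ a b r → advancedFrom k a b r ≡ b
  advancedFrom-k a b r with k ≤? toℕ r
  ... | yes k≤r = contradiction k≤r (<⇒≱ (toℕ<n r))
  ... | no _    = refl

  advancedFrom-at : ∀ {a b i} r → toℕ r ≡ i → advancedFrom i a b r ≡ a
  advancedFrom-at {i = i} r r≡i with i ≤? toℕ r
  ... | yes _   = refl
  ... | no i≰r  = contradiction (≤-reflexive (sym r≡i)) i≰r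

  advancedFrom-suc-at : ∀ {a b i} r → toℕ r ≡ i → advancedFrom (suc i) a b r ≡ b
  advancedFrom-suc-at {i = i} r r≡i with suc i ≤? toℕ r
  ... | yes i<r = contradiction i<r (<-irrefl (sym r≡i))
  ... | no _    = refl

  advancedFrom-suc-other : ∀ {a b i} r → toℕ r ≢ i →
                           advancedFrom (suc i) a b r ≡ advancedFrom i a b r
  advancedFrom-suc-other {i = i} r r≢i with suc i ≤? toℕ r | i ≤? toℕ r
  ... | yes _   | yes _   = refl
  ... | no _    | no _    = refl
  ... | yes i<r | no i≰r  = contradiction (<⇒≤ i<r) i≰r
  ... | no i≮r  | yes i≤r = contradiction (≤∧≢⇒< i≤r (λ i≡r → r≢i (sym i≡r))) i≮r

  synchronousDelay⇒localDelays :
    ∀ {q q' t δ} (ν ν' : LVal) → LValid ν → LValid ν' → 𝟘 ≤ δ →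
    (∀ p → q' p ≡ q p) → (∀ p x → loff ν' p x ≡ loff ν p x) →
    (∀ p → lnow ν p ≡ t) → (∀ p → lnow ν' p ≡ (t + δ)) →
    LDelays q ν q' ν'
  synchronousDelay⇒localDelays {q} {q'} {t} {δ} ν ν' valid valid' 0≤δ q'≗q off'≗off now≗t now'≗t+δ =
    delayProcessesBelow k ≤-refl ν (λ _ _ → refl)
      (λ r → trans (now≗t r) (sym (advancedFrom-k (t + δ) t r))) valid
    where
    front : ℕ → Fin k → T
    front i = advancedFrom i (t + δ) t

    offsetBelowFront : ∀ i p x → loff ν p x ≤ front i p
    offsetBelowFront i p x = advancedFrom-either {P = loff ν p x ≤_} i p
      (subst (λ z → z ≤ (t + δ)) (off'≗off p x) (subst (loff ν' p x ≤_) (now'≗t+δ p) (valid' p x)))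
      (subst (loff ν p x ≤_) (now≗t p) (valid p x))

    delayProcessesBelow : ∀ i → i ≤ℕ k → (μ : LVal) →
      (∀ p x → loff μ p x ≡ loff ν p x) → (∀ r → lnow μ r ≡ front i r) → LValid μ →
      LDelays q μ q' ν'
    delayProcessesBelow zero _ μ off≗ now≗ _ =
      done ( q'≗q
           , (λ p x → trans (off'≗off p x) (sym (off≗ p x)))
           , (λ r → trans (now'≗t+δ r) (sym (trans (now≗ r) (advancedFrom-zero (t + δ) t r)))))
    delayProcessesBelow (suc i) i<k μ off≗ now≗ validμ =
      step p δ
        ( validμ , validμ' , 0≤δ , (λ _ → refl) , (λ r x → sym (off≗ r x))
        , advanceP , keepOthers)
        (delayProcessesBelow i (<⇒≤ i<k) μ' (λ _ _ → refl) (λ _ → refl) validμ')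
      where
      p : Fin k
      p = fromℕ< i<k
      p≡i : toℕ p ≡ i
      p≡i = toℕ-fromℕ< i<k
      μ' : LVal
      μ' = lval (loff ν) (front i)
      validμ' : LValid μ'
      validμ' = offsetBelowFront i
      advanceP : front i p ≡ (lnow μ p + δ)
      advanceP = trans (advancedFrom-at p p≡i)
                       (cong (_+ δ) (sym (trans (now≗ p) (advancedFrom-suc-at p p≡i))))
      keepOthers : ∀ r → ¬ (r ≡ p) → front i r ≡ lnow μ r
      keepOthers r r≢p = trans (sym (advancedFrom-suc-other r r≢i)) (sym (now≗ r))
        where
        r≢i : toℕ r ≢ i
        r≢i r≡i = r≢p (toℕ-injective (trans r≡i (sym p≡i)))

  globalDelay⇒localDelays : ∀ {q v δ q' v'} → GDelay q v δ q' v' → LDelays q (local v) q' (local v')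
  globalDelay⇒localDelays {v = v} {v' = v'} (valid , valid' , 0≤δ , q'≗q , off'≗off , now'≡now+δ) =
    synchronousDelay⇒localDelays (local v) (local v') valid valid' 0≤δ q'≗q off'≗off
      (λ _ → refl) (λ _ → now'≡now+δ)

  globalAct⇒localAct : ∀ {q v b q' v'} → GAct q v b q' v' → LAct q (local v) b q' (local v')
  globalAct⇒localAct (valid , valid' , tr , fits , now'≡now , reset , keep) =
    valid , valid' , (λ _ _ _ _ → refl) , tr , fits , (λ _ → now'≡now) , reset , keep

  globalRun⇒localRun : ∀ q v u q' v' → GRun q v u q' v' → LRun q (local v) u q' (local v')
  globalRun⇒localRun q v [] q' v' (_ , delay) = globalDelay⇒localDelays delay
  globalRun⇒localRun q v (b ∷ u) q' v' (q₁ , v₁ , q₂ , v₂ , (_ , delay) , action , run) =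
    q₁ , local v₁ , q₂ , local v₂ , globalDelay⇒localDelays delay , globalAct⇒localAct action ,
    globalRun⇒localRun q₂ v₂ u q' v' run

lemma12 : (D : TimeDomain) (N : Network) →
    let open Sem D N in
    (q : Network.State N) (v : GVal) (u : List (Fin (Network.nΣ N)))
    (q' : Network.State N) (v' : GVal) →
    GRun q v u q' v' → LRun q (local v) u q' (local v')
lemma12 = globalRun⇒localRun
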